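{- Let $d\ge 5$ and let $A\subseteq\mathbb{Z}_{2d}$ with $|A|=d$ contain both odd and even elements. Then for every $2\le s\le d-2$ we have $\left|\sum\binom{A}{s}\right|>d$.
   Context: For a subset $A$ of an abelian group and an integer $s\ge 2$, $\sum\binom{A}{s}$ denotes the restricted $s$-sumset: the set of all sums $a_1+\dots+a_s$ with $a_1,\dots,a_s$ distinct elements of $A$. -}

module Defs where

open import Data.Nat using (ℕ; zero; suc; _%_)
open import Data.Bool using (if_then_else_)
open import Data.Fin using (Fin; toℕ)
open import Data.Fin.Subset using (Subset; _⊆_; ∣_∣)
open import Data.Vec using (lookup)
open import Data.List using (map; allFin)
open import Data.Nat.ListAction using (sum)
open import Data.Product using (Σ; _×_)
open import Relation.Binary.PropositionalEquality using (_≡_)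

-- Reduction of a natural number modulo n (n = 0 is never used below).
modN : ℕ → ℕ → ℕ
modN zero    m = m
modN (suc n) m = m % suc n

subsetSum : {n : ℕ} → Subset n → ℕ
subsetSum {n} B = sum (map (λ i → if lookup B i then toℕ i else 0) (allFin n))

InRestrictedSumset : {n : ℕ} → Subset n → ℕ → Fin n → Set
InRestrictedSumset {n} A s x =
  Σ (Subset n) (λ B → (B ⊆ A) × (∣ B ∣ ≡ s) × (modN n (subsetSum B) ≡ toℕ x))

module Submission where

-- List A as w₀ < w₁ < … < w_{d-1} in [0, 2d) and set w_d = w₀ + 2d. In a window of d consecutive
-- terms let B consist of the first s; exchanging its p-th term for its q-th (p < s ≤ q) moves the sum
-- by w_q − w_p, which lies in (0, 2d). A monotone staircase of such exchanges gives d − 1 distinct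
-- shifts, and one more as soon as two gaps w_{p+1} − w_p and w_{q+1} − w_q with p + 1 < s ≤ q < d − 1
-- differ; with B itself this makes d + 1 distinct sums modulo 2d. So if the restricted sumset had at
-- most d elements, the windows starting at w₀ and at w₁ would force all d gaps to be equal, hence
-- equal to 2, and A would consist of elements of one parity.

open import Defs
open import Data.Bool using (if_then_else_)
open import Data.Empty using (⊥-elim)
open import Data.Fin using (Fin; toℕ; zero; suc)
import Data.Fin.Properties as Fin
open import Data.Fin.Subset using (Subset; Side; _∈_; _∉_; _⊆_; ∣_∣; inside; outside; ⊥)
open import Data.Fin.Subset.Properties using (_∈?_; drop-not-there; ∉⊥; ∣⊥∣≡0; p⊆q⇒∣p∣≤∣q∣)
open import Data.List using (List; []; _∷_; _++_; applyUpTo; filter; length; tabulate; map; allFin)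
open import Data.List.Properties using (map-tabulate; tabulate-cong; length-applyUpTo; length-map)
open import Data.List.Membership.Propositional using () renaming (_∈_ to _∈ₗ_)
open import Data.List.Membership.Propositional.Properties
  using (∈-applyUpTo⁺; ∈-applyUpTo⁻; ∈-map⁺; ∈-map⁻; ∈-filter⁺; ∈-allFin)
open import Data.List.Relation.Unary.All as All using (All; []; _∷_)
import Data.List.Relation.Unary.All.Properties as Allₚ
open import Data.List.Relation.Unary.AllPairs as AllPairs using (AllPairs; []; _∷_)
import Data.List.Relation.Unary.AllPairs.Properties as AllPairsₚ
open import Data.List.Relation.Unary.Any using (here; there)
open import Data.List.Relation.Unary.Linked as Linked using (Linked; []; [-]; _∷_)
open import Data.List.Relation.Unary.Linked.Properties using (Linked⇒AllPairs; AllPairs⇒Linked)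
open import Data.List.Relation.Unary.Unique.Propositional using (Unique)
open import Data.Nat
  using (ℕ; zero; suc; s≤s; z≤n; _+_; _*_; _∸_; _≤_; _<_; _%_; _/_; _≟_; _<?_; NonZero; >-nonZero; >-nonZero⁻¹)
open import Data.Nat.DivMod using (_mod_; m%n<n; m<n⇒m%n≡m; m≡m%n+[m/n]*n; [m+kn]%n≡m%n; [m+n]%n≡m%n)
open import Data.Nat.Divisibility using (_∣_; divides; ∣⇒≤; ∣m∣n⇒∣m+n; ∣m+n∣m⇒∣n; n∣m*n; ∣-trans; ∣-reflexive)
open import Data.Nat.ListAction using (sum)
open import Data.Nat.Properties
  using (≤-refl; ≤-reflexive; ≤-trans; ≤-antisym; ≤-pred; <-trans; <-irrefl; <-cmp; ≤-<-trans; <-≤-trans;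
         <⇒≤; <⇒≢; <⇒≱; n<1+n; n≤1+n; m≤n⇒m≤1+n; m≤n⇒m<n∨m≡n; m≤n⇒∃[o]m+o≡n; m≤m+n; m≤n+m;
         +-identityʳ; +-suc; +-comm; +-assoc; +-cancelˡ-≡; +-cancelʳ-≡; +-monoʳ-<; +-monoˡ-<; +-monoʳ-≤; +-monoˡ-≤;
         *-comm; *-cancelˡ-≡; *-distribʳ-∸; m∸n+n≡m; m+[n∸m]≡n; +-∸-assoc; [m+n]∸[m+o]≡n∸o; m<n⇒0<n∸m;
         m<n+o⇒m∸n<o; ∸-monoʳ-≤; ∸-monoʳ-<; ∸-monoˡ-<)
open import Data.Nat.Tactic.RingSolver using (solve-∀)
open import Data.Product using (Σ; _×_; _,_; ∃)
open import Data.Sum using (inj₁; inj₂)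
open import Data.Vec using ([]; _∷_; _[_]≔_; lookup; here; there)
open import Data.Vec.Properties
  using ([]=⇒lookup; lookup⇒[]=; lookup∘update′; []≔-updates; []≔-minimal; []≔-idempotent; []≔-lookup)
open import Function using (_∘_)
open import Function.Bundles using (_⇔_; Equivalence)
open import Relation.Binary.Definitions using (Tri; tri<; tri≈; tri>)
open import Relation.Binary.PropositionalEquality
open import Relation.Nullary using (¬_; yes; no; contradiction)
open import Relation.Nullary.Decidable using (decidable-stable)

private
  variable
    n : ℕ

insert : Fin n → Subset n → Subset n
insert x p = p [ x ]≔ inside

∣insert∣ : {x : Fin n} (p : Subset n) → x ∉ p → ∣ insert x p ∣ ≡ suc ∣ p ∣
∣insert∣ {x = zero}  (outside ∷ p) x∉p = refl
∣insert∣ {x = zero}  (inside ∷ p)  x∉p = contradiction here x∉p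
∣insert∣ {x = suc x} (outside ∷ p) x∉p = ∣insert∣ p (drop-not-there x∉p)
∣insert∣ {x = suc x} (inside ∷ p)  x∉p = cong suc (∣insert∣ p (drop-not-there x∉p))

-- Σ_{i ∈ p} (k + i); the offset k makes the sum structurally recursive in p.
shiftedSum : ℕ → Subset n → ℕ
shiftedSum k []      = 0
shiftedSum k (b ∷ p) = (if b then k else 0) + shiftedSum (suc k) p

shiftedSum-tabulate : (k : ℕ) (p : Subset n) →
  sum (tabulate (λ i → if lookup p i then k + toℕ i else 0)) ≡ shiftedSum k p
shiftedSum-tabulate k []      = refl
shiftedSum-tabulate k (b ∷ p) = cong₂ _+_
  (cong (λ m → if b then m else 0) (+-identityʳ k))
  (trans (cong sum (tabulate-cong λ i → cong (λ m → if lookup p i then m else 0) (+-suc k (toℕ i))))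
         (shiftedSum-tabulate (suc k) p))

subsetSum≡shiftedSum : (p : Subset n) → subsetSum p ≡ shiftedSum 0 p
subsetSum≡shiftedSum {n} p =
  trans (cong sum (map-tabulate {n = n} (λ i → i) (λ i → if lookup p i then toℕ i else 0))) (shiftedSum-tabulate 0 p)

shiftedSum-insert : (k : ℕ) {x : Fin n} (p : Subset n) → x ∉ p →
  shiftedSum k (insert x p) ≡ (k + toℕ x) + shiftedSum k p
shiftedSum-insert k {zero}  (outside ∷ p) x∉p = cong (_+ shiftedSum (suc k) p) (sym (+-identityʳ k))
shiftedSum-insert k {zero}  (inside ∷ p)  x∉p = contradiction here x∉p
shiftedSum-insert k {suc x} (b ∷ p)       x∉p = begin
  c + shiftedSum (suc k) (insert x p)          ≡⟨ cong (c +_) (shiftedSum-insert (suc k) p (drop-not-there x∉p)) ⟩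
  c + (suc k + toℕ x + shiftedSum (suc k) p)   ≡⟨ rearrange c k (toℕ x) _ ⟩
  k + suc (toℕ x) + (c + shiftedSum (suc k) p) ∎
  where
  open ≡-Reasoning
  c = if b then k else 0
  rearrange : ∀ c k x r → c + (suc k + x + r) ≡ k + suc x + (c + r)
  rearrange = solve-∀

subsetSum-insert : {x : Fin n} (p : Subset n) → x ∉ p → subsetSum (insert x p) ≡ toℕ x + subsetSum p
subsetSum-insert {x = x} p x∉p = begin
  subsetSum (insert x p)       ≡⟨ subsetSum≡shiftedSum (insert x p) ⟩
  shiftedSum 0 (insert x p)    ≡⟨ shiftedSum-insert 0 p x∉p ⟩
  toℕ x + shiftedSum 0 p       ≡⟨ cong (toℕ x +_) (sym (subsetSum≡shiftedSum p)) ⟩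
  toℕ x + subsetSum p          ∎
  where open ≡-Reasoning

∈-update⁻ : {x y : Fin n} {p : Subset n} {v : Side} → x ≢ y → x ∈ p [ y ]≔ v → x ∈ p
∈-update⁻ {p = p} x≢y x∈ = lookup⇒[]= _ p (trans (sym (lookup∘update′ x≢y p _)) ([]=⇒lookup x∈))

∈-insert⁺ : {x y : Fin n} {p : Subset n} → y ∈ p → y ∈ insert x p
∈-insert⁺ {x = x} {y} {p} y∈p with y Fin.≟ x
... | yes refl = []≔-updates p x
... | no y≢x   = []≔-minimal p y x y≢x y∈p

x∉p[x]≔outside : {x : Fin n} (p : Subset n) → x ∉ p [ x ]≔ outside
x∉p[x]≔outside {x = x} p x∈ with () ← trans (sym ([]=⇒lookup x∈)) ([]=⇒lookup ([]≔-updates p x))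

p[x]≔outside⊆p : {x : Fin n} {p : Subset n} → p [ x ]≔ outside ⊆ p
p[x]≔outside⊆p {x = x} {p} {y} y∈ with y Fin.≟ x
... | yes refl = contradiction y∈ (x∉p[x]≔outside p)
... | no y≢x   = ∈-update⁻ y≢x y∈

insert-removed : {x : Fin n} (p : Subset n) → x ∈ p → insert x (p [ x ]≔ outside) ≡ p
insert-removed {x = x} p x∈p = begin
  (p [ x ]≔ outside) [ x ]≔ inside ≡⟨ []≔-idempotent p x ⟩
  p [ x ]≔ inside                  ≡⟨ cong (p [ x ]≔_) (sym ([]=⇒lookup x∈p)) ⟩
  p [ x ]≔ lookup p x              ≡⟨ []≔-lookup p x ⟩
  p                                ∎
  where open ≡-Reasoning

exchange : Fin n → Fin n → Subset n → Subset n
exchange b c B = insert c (B [ b ]≔ outside)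

module _ {B : Subset n} {b c : Fin n} (b∈B : b ∈ B) (c∉B : c ∉ B) where

  private
    B⁻ = B [ b ]≔ outside

    c∉B⁻ : c ∉ B⁻
    c∉B⁻ = c∉B ∘ p[x]≔outside⊆p

    B≡ : insert b B⁻ ≡ B
    B≡ = insert-removed B b∈B

  ∣exchange∣ : ∣ exchange b c B ∣ ≡ ∣ B ∣
  ∣exchange∣ = begin
    ∣ insert c B⁻ ∣ ≡⟨ ∣insert∣ B⁻ c∉B⁻ ⟩
    suc ∣ B⁻ ∣      ≡⟨ sym (∣insert∣ B⁻ (x∉p[x]≔outside B)) ⟩
    ∣ insert b B⁻ ∣ ≡⟨ cong ∣_∣ B≡ ⟩
    ∣ B ∣           ∎
    where open ≡-Reasoning

  subsetSum-exchange : subsetSum (exchange b c B) + toℕ b ≡ subsetSum B + toℕ c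
  subsetSum-exchange = begin
    subsetSum (insert c B⁻) + toℕ b    ≡⟨ cong (_+ toℕ b) (subsetSum-insert B⁻ c∉B⁻) ⟩
    toℕ c + subsetSum B⁻ + toℕ b       ≡⟨ rearrange (toℕ c) (subsetSum B⁻) (toℕ b) ⟩
    toℕ b + subsetSum B⁻ + toℕ c       ≡⟨ cong (_+ toℕ c) (sym (subsetSum-insert B⁻ (x∉p[x]≔outside B))) ⟩
    subsetSum (insert b B⁻) + toℕ c    ≡⟨ cong (λ p → subsetSum p + toℕ c) B≡ ⟩
    subsetSum B + toℕ c                ∎
    where
    open ≡-Reasoning
    rearrange : ∀ x y z → x + y + z ≡ z + y + x
    rearrange = solve-∀

  exchange-⊆ : {A : Subset n} → B ⊆ A → c ∈ A → exchange b c B ⊆ A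
  exchange-⊆ B⊆A c∈A {x} x∈ with x Fin.≟ c
  ... | yes refl = c∈A
  ... | no x≢c   = B⊆A (p[x]≔outside⊆p (∈-update⁻ x≢c x∈))

fromList : List (Fin n) → Subset n
fromList []       = ⊥
fromList (x ∷ xs) = insert x (fromList xs)

∈-fromList⁺ : {x : Fin n} {xs : List (Fin n)} → x ∈ₗ xs → x ∈ fromList xs
∈-fromList⁺ {xs = x ∷ xs} (here refl) = []≔-updates (fromList xs) x
∈-fromList⁺ {xs = x ∷ xs} (there x∈)  = ∈-insert⁺ (∈-fromList⁺ x∈)

∈-fromList⁻ : {x : Fin n} {xs : List (Fin n)} → x ∈ fromList xs → x ∈ₗ xs
∈-fromList⁻ {xs = []}     x∈ = contradiction x∈ ∉⊥
∈-fromList⁻ {x = x} {xs = y ∷ xs} x∈ with x Fin.≟ y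
... | yes refl = here refl
... | no x≢y   = there (∈-fromList⁻ (∈-update⁻ x≢y x∈))

∣fromList∣ : {xs : List (Fin n)} → Unique xs → ∣ fromList xs ∣ ≡ length xs
∣fromList∣ {n} {[]}     []           = ∣⊥∣≡0 n
∣fromList∣ {xs = x ∷ xs} (x∉xs ∷ xs!) =
  trans (∣insert∣ (fromList xs) (λ x∈ → All.lookup x∉xs (∈-fromList⁻ x∈) refl)) (cong suc (∣fromList∣ xs!))

Unique⇒length≤∣∣ : {xs : List (Fin n)} {S : Subset n} → Unique xs → All (_∈ S) xs → length xs ≤ ∣ S ∣
Unique⇒length≤∣∣ {xs = xs} xs! xs⊆S =
  ≤-trans (≤-reflexive (sym (∣fromList∣ xs!))) (p⊆q⇒∣p∣≤∣q∣ (All.lookup xs⊆S ∘ ∈-fromList⁻))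

∣∣≡length : {xs : List (Fin n)} {S : Subset n} → Unique xs → All (_∈ S) xs → (∀ {x} → x ∈ S → x ∈ₗ xs) →
            ∣ S ∣ ≡ length xs
∣∣≡length xs! xs⊆S S⊆xs = ≤-antisym
  (≤-trans (p⊆q⇒∣p∣≤∣q∣ (∈-fromList⁺ ∘ S⊆xs)) (≤-reflexive (∣fromList∣ xs!)))
  (Unique⇒length≤∣∣ xs! xs⊆S)

module _ {n : ℕ} .{{_ : NonZero n}} where

  toℕ-mod : (m : ℕ) → toℕ (m mod n) ≡ m % n
  toℕ-mod m = Fin.toℕ-fromℕ< (m%n<n m n)

  mod-toℕ : (i : Fin n) → toℕ i mod n ≡ i
  mod-toℕ i = Fin.toℕ-injective (trans (toℕ-mod (toℕ i)) (m<n⇒m%n≡m (Fin.toℕ<n i)))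

  %≡%⇒∣∸ : ∀ {x y} → x % n ≡ y % n → n ∣ y ∸ x
  %≡%⇒∣∸ {x} {y} x%n≡y%n = divides (y / n ∸ x / n) (begin
    y ∸ x                                       ≡⟨ cong₂ _∸_ (m≡m%n+[m/n]*n y n) (m≡m%n+[m/n]*n x n) ⟩
    (y % n + y / n * n) ∸ (x % n + x / n * n)   ≡⟨ cong (λ r → (y % n + y / n * n) ∸ (r + x / n * n)) x%n≡y%n ⟩
    (y % n + y / n * n) ∸ (y % n + x / n * n)   ≡⟨ [m+n]∸[m+o]≡n∸o (y % n) _ _ ⟩
    y / n * n ∸ x / n * n                       ≡⟨ sym (*-distribʳ-∸ n (y / n) (x / n)) ⟩
    (y / n ∸ x / n) * n                         ∎)
    where open ≡-Reasoning

  distinct-mod : ∀ {x y} → x < y → y < x + n → x mod n ≢ y mod n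
  distinct-mod {x} {y} x<y y<x+n eq = <⇒≱ (m<n+o⇒m∸n<o y x y<x+n) (∣⇒≤ ∣δ)
    where
    instance _ = >-nonZero (m<n⇒0<n∸m x<y)
    ∣δ : n ∣ y ∸ x
    ∣δ = %≡%⇒∣∸ (trans (sym (toℕ-mod x)) (trans (cong toℕ eq) (toℕ-mod y)))

  %-exchange : ∀ X σ {a b} → a ≤ b → X + a % n ≡ σ + b % n → X % n ≡ (σ + (b ∸ a)) % n
  %-exchange X σ {a} {b} a≤b eq = begin
    X % n                                  ≡⟨ sym ([m+kn]%n≡m%n X (b / n) n) ⟩
    (X + b / n * n) % n                    ≡⟨ cong (_% n) (+-cancelʳ-≡ a _ _ lifted) ⟩
    (σ + (b ∸ a) + a / n * n) % n          ≡⟨ [m+kn]%n≡m%n (σ + (b ∸ a)) (a / n) n ⟩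
    (σ + (b ∸ a)) % n                      ∎
    where
    open ≡-Reasoning
    lifted : X + b / n * n + a ≡ σ + (b ∸ a) + a / n * n + a
    lifted = begin
      X + b / n * n + a                    ≡⟨ cong (X + b / n * n +_) (m≡m%n+[m/n]*n a n) ⟩
      X + b / n * n + (a % n + a / n * n)  ≡⟨ shuffle₁ X _ _ _ ⟩
      X + a % n + (b / n * n + a / n * n)  ≡⟨ cong (_+ (b / n * n + a / n * n)) eq ⟩
      σ + b % n + (b / n * n + a / n * n)  ≡⟨ shuffle₂ σ _ _ _ ⟩
      σ + (b % n + b / n * n) + a / n * n  ≡⟨ cong (λ t → σ + t + a / n * n) (sym (m≡m%n+[m/n]*n b n)) ⟩
      σ + b + a / n * n                    ≡⟨ cong (λ t → σ + t + a / n * n) (sym (m∸n+n≡m a≤b)) ⟩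
      σ + (b ∸ a + a) + a / n * n          ≡⟨ shuffle₃ σ _ a _ ⟩
      σ + (b ∸ a) + a / n * n + a          ∎
      where
      shuffle₁ : ∀ x u v w → x + u + (v + w) ≡ x + v + (u + w)
      shuffle₁ = solve-∀
      shuffle₂ : ∀ x u v w → x + u + (v + w) ≡ x + (u + v) + w
      shuffle₂ = solve-∀
      shuffle₃ : ∀ x u v w → x + (u + v) + w ≡ x + u + w + v
      shuffle₃ = solve-∀

-- A cell (p , q) stands for exchanging the p-th element of an increasing list for the q-th one.
Cell : Set
Cell = ℕ × ℕ

Valid : ℕ → ℕ → Cell → Set
Valid s d (p , q) = p < s × s ≤ q × q < d

column : ℕ → ℕ → ℕ → List Cell → List Cell
column p q zero    ks = (p , q) ∷ ks
column p q (suc b) ks = (p , q) ∷ column p (suc q) b ks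

hook : ℕ → ℕ → ℕ → ℕ → List Cell → List Cell
hook p q zero    b ks = column p q b ks
hook p q (suc a) b ks = (p + suc a , q) ∷ hook p q a b ks

length-hook : ∀ p q a b ks → length (hook p q a b ks) ≡ suc (a + b) + length ks
length-hook p q (suc a) b ks = cong suc (length-hook p q a b ks)
length-hook p q zero    b ks = length-column p q b
  where
  length-column : ∀ p q b → length (column p q b ks) ≡ suc b + length ks
  length-column p q zero    = refl
  length-column p q (suc b) = cong suc (length-column p (suc q) b)

module _ {s d : ℕ} where

  column-valid : ∀ {p q} b {ks} → p < s → s ≤ q → q + b < d →
                 All (Valid s d) ks → All (Valid s d) (column p q b ks)
  column-valid {q = q} zero    p<s s≤q q<d ks =
    (p<s , s≤q , subst (_< d) (+-identityʳ q) q<d) ∷ ks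
  column-valid {q = q} (suc b) p<s s≤q q+b<d ks =
    (p<s , s≤q , ≤-<-trans (m≤m+n q (suc b)) q+b<d) ∷
    column-valid b p<s (m≤n⇒m≤1+n s≤q) (subst (_< d) (+-suc q b) q+b<d) ks

  hook-valid : ∀ {p q} a b {ks} → p + a < s → s ≤ q → q + b < d →
               All (Valid s d) ks → All (Valid s d) (hook p q a b ks)
  hook-valid {p} zero    b p<s s≤q q+b<d ks = column-valid b (subst (_< s) (+-identityʳ p) p<s) s≤q q+b<d ks
  hook-valid {p} {q} (suc a) b p+a<s s≤q q+b<d ks =
    (p+a<s , s≤q , ≤-<-trans (m≤m+n q b) q+b<d) ∷
    hook-valid a b (<-trans (+-monoʳ-< p (n<1+n a)) p+a<s) s≤q q+b<d ks

module Increasing (W : ℕ → ℕ) (W-inc : ∀ k → W k < W (suc k)) where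

  W-mono-≤ : ∀ {k l} → k ≤ l → W k ≤ W l
  W-mono-≤ {k} k≤l with m , refl ← m≤n⇒∃[o]m+o≡n k≤l = go m
    where
    go : ∀ m → W k ≤ W (k + m)
    go zero    = ≤-reflexive (cong W (sym (+-identityʳ k)))
    go (suc m) = ≤-trans (go m) (≤-trans (<⇒≤ (W-inc (k + m))) (≤-reflexive (cong W (sym (+-suc k m)))))

  W-mono-< : ∀ {k l} → k < l → W k < W l
  W-mono-< {k} k<l = <-≤-trans (W-inc k) (W-mono-≤ k<l)

  gap : ℕ → ℕ
  gap k = W (suc k) ∸ W k

  diff : Cell → ℕ
  diff (p , q) = W q ∸ W p

  diff-row : ∀ {p q} → suc p ≤ q → diff (suc p , q) < diff (p , q)
  diff-row {p} p<q = ∸-monoʳ-< (W-inc p) (W-mono-≤ p<q)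

  diff-column : ∀ {p q} → p ≤ q → diff (p , q) < diff (p , suc q)
  diff-column {q = q} p≤q = ∸-monoˡ-< (W-inc q) (W-mono-≤ p≤q)

  diff-square : ∀ {p q} → suc p ≤ q → diff (p , q) ≡ diff (suc p , suc q) → gap p ≡ gap q
  diff-square {p} {q} p<q eq = +-cancelˡ-≡ (diff (suc p , q)) _ _ (begin
    diff (suc p , q) + gap p   ≡⟨ sym (∸-split (W-mono-≤ (n≤1+n p)) (W-mono-≤ p<q)) ⟩
    diff (p , q)               ≡⟨ eq ⟩
    diff (suc p , suc q)       ≡⟨ ∸-split (W-mono-≤ p<q) (W-mono-≤ (n≤1+n q)) ⟩
    gap q + diff (suc p , q)   ≡⟨ +-comm (gap q) _ ⟩
    diff (suc p , q) + gap q   ∎)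
    where
    open ≡-Reasoning
    ∸-split : ∀ {u v w} → u ≤ v → v ≤ w → w ∸ u ≡ (w ∸ v) + (v ∸ u)
    ∸-split {u} {v} {w} u≤v v≤w = begin
      w ∸ u             ≡⟨ cong (_∸ u) (sym (m∸n+n≡m v≤w)) ⟩
      (w ∸ v) + v ∸ u   ≡⟨ +-∸-assoc (w ∸ v) u≤v ⟩
      (w ∸ v) + (v ∸ u) ∎

  arithmetic : ∀ {c d} → (∀ k → k < d → gap k ≡ c) → ∀ k → k ≤ d → W k ≡ W 0 + k * c
  arithmetic         gaps zero    _    = sym (+-identityʳ (W 0))
  arithmetic {c} {d} gaps (suc k) k<d = begin
    W (suc k)          ≡⟨ sym (m+[n∸m]≡n (<⇒≤ (W-inc k))) ⟩
    W k + gap k        ≡⟨ cong₂ _+_ (arithmetic gaps k (<⇒≤ k<d)) (gaps k k<d) ⟩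
    W 0 + k * c + c    ≡⟨ +-assoc (W 0) (k * c) c ⟩
    W 0 + (k * c + c)  ≡⟨ cong (W 0 +_) (+-comm (k * c) c) ⟩
    W 0 + suc k * c    ∎
    where open ≡-Reasoning

  column-linked : ∀ {δ p q} b {ks} → p ≤ q → δ < diff (p , q) →
                  Linked _<_ (diff (p , q + b) ∷ map diff ks) → Linked _<_ (δ ∷ map diff (column p q b ks))
  column-linked {p = p} {q} zero {ks} p≤q δ< rest =
    δ< ∷ subst (λ t → Linked _<_ (diff (p , t) ∷ map diff ks)) (+-identityʳ q) rest
  column-linked {p = p} {q} (suc b) {ks} p≤q δ< rest =
    δ< ∷ column-linked b (m≤n⇒m≤1+n p≤q) (diff-column p≤q)
           (subst (λ t → Linked _<_ (diff (p , t) ∷ map diff ks)) (+-suc q b) rest)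

  hook-linked : ∀ {δ p q} a b {ks} → p + a ≤ q → δ < diff (p + a , q) →
                Linked _<_ (diff (p , q + b) ∷ map diff ks) → Linked _<_ (δ ∷ map diff (hook p q a b ks))
  hook-linked {δ} {p} {q} zero b p≤q δ< rest =
    column-linked b (subst (_≤ q) (+-identityʳ p) p≤q) (subst (λ t → δ < diff (t , q)) (+-identityʳ p) δ<) rest
  hook-linked {p = p} {q} (suc a) b p+a<q δ< rest =
    δ< ∷ hook-linked a b (<⇒≤ p+a<q′) (subst (λ t → diff (t , q) < diff (p + a , q)) (sym (+-suc p a)) (diff-row p+a<q′)) rest
    where
    p+a<q′ : suc (p + a) ≤ q
    p+a<q′ = subst (_≤ q) (+-suc p a) p+a<q

  path-through : ∀ p a b c {u v} →
    let s = suc (suc p) + a; q = s + b; d = suc (suc q) + c in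
    Valid s d u → Valid s d v → diff (suc p , q) < diff u → diff u < diff v → diff v < diff (p , suc q) →
    ∃ λ cs → All (Valid s d) cs × Linked _<_ (0 ∷ map diff cs) × length cs ≡ d
  path-through p a b c {u} {v} u-valid v-valid L<u u<v v<T = path , path-valid , path-linked , path-length
    where
    s = suc (suc p) + a
    q = s + b
    d = suc (suc q) + c

    path : List Cell
    path = hook (suc p) s a b (u ∷ v ∷ hook 0 (suc q) p c [])

    p<s : p < s
    p<s = s≤s (≤-trans (n≤1+n p) (m≤m+n (suc p) a))

    s≤q+1 : s ≤ suc q
    s≤q+1 = m≤n⇒m≤1+n (m≤m+n s b)

    path-valid : All (Valid s d) path
    path-valid = hook-valid a b ≤-refl ≤-refl (s≤s (≤-trans (n≤1+n q) (m≤m+n (suc q) c)))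
      (u-valid ∷ v-valid ∷ hook-valid p c p<s s≤q+1 ≤-refl [])

    path-linked : Linked _<_ (0 ∷ map diff path)
    path-linked = hook-linked a b (n≤1+n _) (m<n⇒0<n∸m (W-mono-< ≤-refl))
      (L<u ∷ u<v ∷ hook-linked p c (≤-trans (<⇒≤ p<s) s≤q+1) v<T [-])

    path-length : length path ≡ d
    path-length = begin
      length path                                                ≡⟨ length-hook (suc p) s a b _ ⟩
      suc (a + b) + suc (suc (length (hook 0 (suc q) p c [])))   ≡⟨ cong (λ l → suc (a + b) + suc (suc l)) (length-hook 0 (suc q) p c []) ⟩
      suc (a + b) + suc (suc (suc (p + c) + 0))                  ≡⟨ count a b c p ⟩
      d                                                          ∎
      where
      open ≡-Reasoning
      count : ∀ a b c p → suc (a + b) + suc (suc (suc (p + c) + 0)) ≡ suc (suc (suc (suc p) + a + b)) + c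
      count = solve-∀

  -- Around the square (p , q), (p + 1 , q + 1) the staircase can take both corners, as their diffs
  -- differ exactly when the gaps at p and q do.
  staircase : ∀ {s d p q} → suc p < s → s ≤ q → suc q < d → gap p ≢ gap q →
              ∃ λ cs → All (Valid s d) cs × Linked _<_ (0 ∷ map diff cs) × length cs ≡ d
  staircase {p = p} p+1<s s≤q q+1<d gap≢
    with a , refl ← m≤n⇒∃[o]m+o≡n p+1<s
       | b , refl ← m≤n⇒∃[o]m+o≡n s≤q
       | c , refl ← m≤n⇒∃[o]m+o≡n q+1<d
    = by-order (<-cmp (diff (p , q)) (diff (suc p , suc q)))
    where
    s = suc (suc p) + a
    q = s + b
    d = suc (suc q) + c

    p+1≤q : suc p ≤ q
    p+1≤q = <⇒≤ (<-≤-trans p+1<s s≤q)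

    X-valid : Valid s d (p , q)
    X-valid = <-trans (n<1+n p) p+1<s , s≤q , <-trans (n<1+n q) q+1<d

    Y-valid : Valid s d (suc p , suc q)
    Y-valid = p+1<s , m≤n⇒m≤1+n s≤q , q+1<d

    by-order : Tri (diff (p , q) < diff (suc p , suc q)) (diff (p , q) ≡ diff (suc p , suc q))
                   (diff (suc p , suc q) < diff (p , q)) →
               ∃ λ cs → All (Valid s d) cs × Linked _<_ (0 ∷ map diff cs) × length cs ≡ d
    by-order (tri< X<Y _ _) =
      path-through p a b c X-valid Y-valid (diff-row p+1≤q) X<Y (diff-row (m≤n⇒m≤1+n p+1≤q))
    by-order (tri≈ _ X≡Y _) = ⊥-elim (gap≢ (diff-square p+1≤q X≡Y))
    by-order (tri> _ _ Y<X) =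
      path-through p a b c Y-valid X-valid (diff-column p+1≤q) Y<X (diff-column (<⇒≤ p+1≤q))

module Window {n : ℕ} .{{_ : NonZero n}} (A S : Subset n) (s d : ℕ)
  (sums∈S : ∀ B → B ⊆ A → ∣ B ∣ ≡ s → subsetSum B mod n ∈ S)
  (W : ℕ → ℕ) (W-inc : ∀ k → W k < W (suc k))
  (W-span : ∀ k → k < d → W k < W 0 + n)
  (W∈A : ∀ k → k < d → W k mod n ∈ A)
  where

  open Increasing W W-inc

  element : ℕ → Fin n
  element k = W k mod n

  element-injective : ∀ {k l} → k < l → l < d → element k ≢ element l
  element-injective {k} {l} k<l l<d =
    distinct-mod (W-mono-< k<l) (<-≤-trans (W-span l l<d) (+-monoˡ-≤ n (W-mono-≤ z≤n)))

  B : Subset n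
  B = fromList (applyUpTo element s)

  σ : ℕ
  σ = subsetSum B

  element∈B : ∀ {p} → p < s → element p ∈ B
  element∈B p<s = ∈-fromList⁺ (∈-applyUpTo⁺ element p<s)

  element∉B : ∀ {q} → s ≤ q → q < d → element q ∉ B
  element∉B s≤q q<d q∈B with i , i<s , eq ← ∈-applyUpTo⁻ element (∈-fromList⁻ q∈B) =
    element-injective (<-≤-trans i<s s≤q) q<d (sym eq)

  module _ (s≤d : s ≤ d) where

    ∣B∣ : ∣ B ∣ ≡ s
    ∣B∣ = trans (∣fromList∣ unique) (length-applyUpTo element s)
      where
      unique : Unique (applyUpTo element s)
      unique = AllPairsₚ.applyUpTo⁺₁ element s (λ i<j j<s → element-injective i<j (<-≤-trans j<s s≤d))

    B⊆A : B ⊆ A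
    B⊆A x∈B with i , i<s , refl ← ∈-applyUpTo⁻ element (∈-fromList⁻ x∈B) = W∈A i (<-≤-trans i<s s≤d)

  exchange∈S : ∀ {c} → Valid s d c → (σ + diff c) mod n ∈ S
  exchange∈S {p , q} (p<s , s≤q , q<d) = subst (_∈ S) same-residue (sums∈S B′ B′⊆A ∣B′∣)
    where
    s≤d = ≤-trans s≤q (<⇒≤ q<d)
    B′ = exchange (element p) (element q) B
    B′⊆A = exchange-⊆ (element∈B p<s) (element∉B s≤q q<d) (B⊆A s≤d) (W∈A q q<d)
    ∣B′∣ = trans (∣exchange∣ (element∈B p<s) (element∉B s≤q q<d)) (∣B∣ s≤d)
    same-residue : subsetSum B′ mod n ≡ (σ + diff (p , q)) mod n
    same-residue = Fin.toℕ-injective (trans (toℕ-mod _) (trans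
      (%-exchange (subsetSum B′) σ (W-mono-≤ (<⇒≤ (<-≤-trans p<s s≤q)))
        (subst₂ (λ x y → subsetSum B′ + x ≡ σ + y) (toℕ-mod (W p)) (toℕ-mod (W q))
          (subsetSum-exchange (element∈B p<s) (element∉B s≤q q<d))))
      (sym (toℕ-mod _))))

  diff<n : ∀ {c} → Valid s d c → diff c < n
  diff<n {p , q} (_ , _ , q<d) =
    ≤-<-trans (∸-monoʳ-≤ (W q) (W-mono-≤ z≤n)) (m<n+o⇒m∸n<o (W q) (W 0) (W-span q q<d))

  residue : ℕ → Fin n
  residue δ = (σ + δ) mod n

  residues-unique : ∀ {δs} → All (_< n) δs → AllPairs _<_ δs → Unique (map residue δs)
  residues-unique []             []             = []
  residues-unique (_ ∷ δs<n) (δ<δs ∷ sorted) =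
    Allₚ.map⁺ (All.zipWith distinct (δ<δs , δs<n)) ∷ residues-unique δs<n sorted
    where
    distinct : ∀ {δ δ′} → δ < δ′ × δ′ < n → residue δ ≢ residue δ′
    distinct {δ} {δ′} (δ<δ′ , δ′<n) = distinct-mod (+-monoʳ-< σ δ<δ′)
      (<-≤-trans (+-monoʳ-< σ δ′<n) (≤-trans (+-monoʳ-≤ σ (m≤n+m n δ)) (≤-reflexive (sym (+-assoc σ δ n)))))

  window-bound : s ≤ d → (cs : List Cell) → All (Valid s d) cs → Linked _<_ (0 ∷ map diff cs) → length cs ≡ d →
                 d < ∣ S ∣
  window-bound s≤d cs valid sorted ∣cs∣≡d =
    subst (_≤ ∣ S ∣) ∣residues∣ (Unique⇒length≤∣∣ (residues-unique bounded (Linked⇒AllPairs <-trans sorted)) in-S)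
    where
    bounded : All (_< n) (0 ∷ map diff cs)
    bounded = >-nonZero⁻¹ n ∷ Allₚ.map⁺ (All.map diff<n valid)
    in-S : All (_∈ S) (map residue (0 ∷ map diff cs))
    in-S = subst (λ x → x mod n ∈ S) (sym (+-identityʳ σ)) (sums∈S B (B⊆A s≤d) (∣B∣ s≤d))
         ∷ Allₚ.map⁺ (Allₚ.map⁺ (All.map exchange∈S valid))
    ∣residues∣ : length (map residue (0 ∷ map diff cs)) ≡ suc d
    ∣residues∣ = cong suc (trans (length-map residue (map diff cs)) (trans (length-map diff cs) ∣cs∣≡d))

  gaps-rigid : ¬ d < ∣ S ∣ → ∀ {p q} → suc p < s → s ≤ q → suc q < d → gap p ≡ gap q
  gaps-rigid d≮∣S∣ {p} {q} p+1<s s≤q q+1<d = decidable-stable (gap p ≟ gap q) λ gap≢ →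
    let cs , valid , sorted , ∣cs∣≡d = staircase p+1<s s≤q q+1<d gap≢
    in d≮∣S∣ (window-bound (≤-trans s≤q (<⇒≤ (<-trans (n<1+n q) q+1<d))) cs valid sorted ∣cs∣≡d)

extend : ℕ → List ℕ → ℕ → ℕ
extend t []       k       = k + t
extend t (x ∷ xs) zero    = x
extend t (x ∷ xs) (suc k) = extend t xs k

extend-inc : ∀ {t} xs → Linked _<_ (xs ++ t ∷ []) → ∀ k → extend t xs k < extend t xs (suc k)
extend-inc {t} []           _           k       = n<1+n (k + t)
extend-inc     (x ∷ [])     (x<t ∷ [-]) zero    = x<t
extend-inc     (x ∷ y ∷ xs) (x<y ∷ _)   zero    = x<y
extend-inc     (x ∷ xs)     sorted      (suc k) = extend-inc xs (Linked.tail sorted) k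

extend-∈ : ∀ {t} xs {k} → k < length xs → extend t xs k ∈ₗ xs
extend-∈ (x ∷ xs) {zero}  _         = here refl
extend-∈ (x ∷ xs) {suc k} (s≤s k<) = there (extend-∈ xs k<)

extend-onto : ∀ {t x} xs → x ∈ₗ xs → ∃ λ k → k < length xs × extend t xs k ≡ x
extend-onto (x ∷ xs) (here refl) = 0 , s≤s z≤n , refl
extend-onto (x ∷ xs) (there x∈)  with k , k< , eq ← extend-onto xs x∈ = suc k , s≤s k< , eq

extend-length : ∀ t xs → extend t xs (length xs) ≡ t
extend-length t []       = refl
extend-length t (x ∷ xs) = extend-length t xs

record Enumeration {n : ℕ} .{{_ : NonZero n}} (A : Subset n) (d : ℕ) : Set where
  field
    W      : ℕ → ℕ
    W-inc  : ∀ k → W k < W (suc k)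
    W-wrap : W d ≡ W 0 + n
    W∈A    : ∀ k → k ≤ d → W k mod n ∈ A
    W-onto : ∀ {a} → a ∈ A → ∃ λ k → k < d × toℕ a ≡ W k

module _ {n : ℕ} .{{_ : NonZero n}} {A : Subset n} where

  fromSortedList : ∀ {d} (a₀ : Fin n) (as : List (Fin n)) → length (a₀ ∷ as) ≡ d →
                AllPairs (λ i j → toℕ i < toℕ j) (a₀ ∷ as) → All (_∈ A) (a₀ ∷ as) →
                (∀ {a} → a ∈ A → a ∈ₗ a₀ ∷ as) → Enumeration A d
  fromSortedList {d} a₀ as ∣as∣≡d sorted as⊆A A⊆as = record
    { W      = W
    ; W-inc  = extend-inc xs xs++t-sorted
    ; W-wrap = W-wrap
    ; W∈A    = W∈A
    ; W-onto = W-onto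
    }
    where
    xs = map toℕ (a₀ ∷ as)
    t  = toℕ a₀ + n
    W  = extend t xs

    ∣xs∣≡d : length xs ≡ d
    ∣xs∣≡d = trans (length-map toℕ (a₀ ∷ as)) ∣as∣≡d

    xs++t-sorted : Linked _<_ (xs ++ t ∷ [])
    xs++t-sorted = AllPairs⇒Linked (AllPairsₚ.++⁺ (AllPairsₚ.map⁺ sorted) ([] ∷ [])
      (Allₚ.map⁺ (All.tabulate λ {a} _ → <-≤-trans (Fin.toℕ<n a) (m≤n+m n (toℕ a₀)) ∷ [])))

    W-wrap : W d ≡ W 0 + n
    W-wrap = trans (cong W (sym ∣xs∣≡d)) (extend-length t xs)

    W-onto : ∀ {a} → a ∈ A → ∃ λ k → k < d × toℕ a ≡ W k
    W-onto a∈A with k , k< , eq ← extend-onto {t} xs (∈-map⁺ toℕ (A⊆as a∈A)) =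
      k , subst (k <_) ∣xs∣≡d k< , sym eq

    W∈A : ∀ k → k ≤ d → W k mod n ∈ A
    W∈A k k≤d with m≤n⇒m<n∨m≡n k≤d
    ... | inj₁ k<d with a , a∈ , Wk≡a ← ∈-map⁻ toℕ (extend-∈ xs (subst (k <_) (sym ∣xs∣≡d) k<d)) =
      subst (_∈ A) (sym (trans (cong (_mod n) Wk≡a) (mod-toℕ a))) (All.lookup as⊆A a∈)
    ... | inj₂ refl = subst (_∈ A) (sym wrapped) (All.lookup as⊆A (here refl))
      where
      wrapped : W k mod n ≡ a₀
      wrapped = Fin.toℕ-injective (begin
        toℕ (W k mod n)  ≡⟨ toℕ-mod _ ⟩
        W k % n          ≡⟨ cong (_% n) W-wrap ⟩
        (toℕ a₀ + n) % n ≡⟨ [m+n]%n≡m%n (toℕ a₀) n ⟩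
        toℕ a₀ % n       ≡⟨ m<n⇒m%n≡m (Fin.toℕ<n a₀) ⟩
        toℕ a₀           ∎)
        where open ≡-Reasoning

  enumerate : ∀ {d} → ∣ A ∣ ≡ d → 0 < d → Enumeration A d
  enumerate {d} ∣A∣≡d 0<d =
    from members (trans (sym (∣∣≡length unique members⊆A A⊆members)) ∣A∣≡d) sorted members⊆A A⊆members
    where
    members = filter (_∈? A) (allFin n)

    sorted : AllPairs (λ i j → toℕ i < toℕ j) members
    sorted = AllPairsₚ.filter⁺ (_∈? A) (AllPairsₚ.tabulate⁺-< (λ i<j → i<j))

    unique : Unique members
    unique = AllPairs.map (λ i<j i≡j → <⇒≢ i<j (cong toℕ i≡j)) sorted

    members⊆A : All (_∈ A) members
    members⊆A = Allₚ.all-filter (_∈? A) (allFin n)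

    A⊆members : ∀ {a} → a ∈ A → a ∈ₗ members
    A⊆members a∈A = ∈-filter⁺ (_∈? A) (∈-allFin _) a∈A

    from : ∀ xs → length xs ≡ d → AllPairs (λ i j → toℕ i < toℕ j) xs → All (_∈ A) xs →
           (∀ {a} → a ∈ A → a ∈ₗ xs) → Enumeration A d
    from []       refl _ _ _ = ⊥-elim (<-irrefl refl 0<d)
    from (a ∷ as) ∣xs∣≡d     = fromSortedList a as ∣xs∣≡d

-- The first hypothesis compares the gaps of W 0 < … < W (d - 1), the second those of W 1 < … < W d.
constant-gaps : (g : ℕ → ℕ) {s d : ℕ} → 2 ≤ s → s ≤ d ∸ 2 → 5 ≤ d →
  (∀ {p q} → suc p < s → s ≤ q → suc q < d → g p ≡ g q) →
  (∀ {p q} → suc p < s → s ≤ q → suc q < d → g (suc p) ≡ g (suc q)) →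
  ∀ k → k < d → g k ≡ g 0
constant-gaps g {s} {suc (suc e)} 2≤s s≤e 5≤d@(s≤s (s≤s _)) rigid₀ rigid₁ = gaps
  where
  s+1<d : suc s < suc (suc e)
  s+1<d = s≤s (s≤s s≤e)

  right : ∀ {q} → s ≤ q → suc q < suc (suc e) → g q ≡ g 0
  right s≤q q+1<d = sym (rigid₀ 2≤s s≤q q+1<d)

  g₁≡g₀ : g 1 ≡ g 0
  g₁≡g₀ with m≤n⇒m<n∨m≡n 2≤s
  ... | inj₁ 2<s = trans (rigid₀ 2<s ≤-refl s+1<d) (right ≤-refl s+1<d)
  ... | inj₂ 2≡s = trans (rigid₁ 2≤s (≤-reflexive (sym 2≡s)) (<⇒≤ 5≤d))
                         (right (≤-trans (≤-reflexive (sym 2≡s)) (n≤1+n 2)) 5≤d)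

  last : g (suc e) ≡ g 0
  last = trans (sym (rigid₁ 2≤s s≤e ≤-refl)) g₁≡g₀

  penultimate : ∀ k → suc k ≡ s → g k ≡ g 0
  penultimate zero    1≡s   = contradiction (subst (2 ≤_) (sym 1≡s) 2≤s) λ { (s≤s ()) }
  penultimate (suc k) k+2≡s = trans (rigid₁ (≤-reflexive k+2≡s) s≤e ≤-refl) last

  gaps : ∀ k → k < suc (suc e) → g k ≡ g 0
  gaps k k<d with <-cmp (suc k) s
  ... | tri< k+1<s _ _ = trans (rigid₀ k+1<s ≤-refl s+1<d) (right ≤-refl s+1<d)
  ... | tri≈ _ k+1≡s _ = penultimate k k+1≡s
  ... | tri> _ _ s<k+1 with m≤n⇒m<n∨m≡n k<d
  ...   | inj₁ k+1<d = right (≤-pred s<k+1) k+1<d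
  ...   | inj₂ refl  = last

parity-shift : ∀ {g} c k l → 2 ∣ g → 2 ∣ c + k * g → 2 ∣ c + l * g
parity-shift c k l 2∣g 2∣c+kg = ∣m∣n⇒∣m+n 2∣c (∣-trans 2∣g (n∣m*n l))
  where
  2∣c : 2 ∣ c
  2∣c = ∣m+n∣m⇒∣n (subst (2 ∣_) (+-comm c _) 2∣c+kg) (∣-trans 2∣g (n∣m*n k))

module Rigidity {n : ℕ} .{{_ : NonZero n}} {A S : Subset n} {s d : ℕ}
  (sums∈S : ∀ B → B ⊆ A → ∣ B ∣ ≡ s → subsetSum B mod n ∈ S)
  (E : Enumeration A d) (d≮∣S∣ : ¬ d < ∣ S ∣) (2≤s : 2 ≤ s) (s≤d∸2 : s ≤ d ∸ 2) (5≤d : 5 ≤ d)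
  where

  open Enumeration E
  open Increasing W W-inc

  equal-gaps : ∀ k → k < d → gap k ≡ gap 0
  equal-gaps = constant-gaps gap 2≤s s≤d∸2 5≤d
    (Window.gaps-rigid A S s d sums∈S W W-inc span₀ (λ k → W∈A k ∘ <⇒≤) d≮∣S∣)
    (Window.gaps-rigid A S s d sums∈S (W ∘ suc) (W-inc ∘ suc) span₁ (λ k → W∈A (suc k)) d≮∣S∣)
    where
    span₀ : ∀ k → k < d → W k < W 0 + n
    span₀ k k<d = <-≤-trans (W-mono-< k<d) (≤-reflexive W-wrap)
    span₁ : ∀ k → k < d → W (suc k) < W 1 + n
    span₁ k k<d = ≤-<-trans (W-mono-≤ k<d) (subst (_< W 1 + n) (sym W-wrap) (+-monoˡ-< n (W-inc 0)))

  on-progression : ∀ {a} → a ∈ A → ∃ λ k → toℕ a ≡ W 0 + k * gap 0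
  on-progression a∈A with k , k<d , a≡Wk ← W-onto a∈A = k , trans a≡Wk (arithmetic equal-gaps k (<⇒≤ k<d))

  same-parity : n ≡ 2 * d → ∀ {a b} → a ∈ A → b ∈ A → 2 ∣ toℕ a → 2 ∣ toℕ b
  same-parity n≡2d a∈A b∈A 2∣a
    with k , a≡ ← on-progression a∈A | l , b≡ ← on-progression b∈A =
    subst (2 ∣_) (sym b≡) (parity-shift (W 0) k l (∣-reflexive (sym gap≡2)) (subst (2 ∣_) a≡ 2∣a))
    where
    instance _ = >-nonZero (≤-trans (s≤s z≤n) 5≤d)
    gap≡2 : gap 0 ≡ 2
    gap≡2 = *-cancelˡ-≡ (gap 0) 2 d (begin
      d * gap 0  ≡⟨ +-cancelˡ-≡ (W 0) _ _ (trans (sym (arithmetic equal-gaps d ≤-refl)) W-wrap) ⟩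
      n          ≡⟨ n≡2d ⟩
      2 * d      ≡⟨ *-comm 2 d ⟩
      d * 2      ∎)
      where open ≡-Reasoning

corollary1 : (d : ℕ) → 5 ≤ d → (A : Subset (2 * d)) → ∣ A ∣ ≡ d →
    Σ (Fin (2 * d)) (λ a → (a ∈ A) × (2 ∣ toℕ a)) →
    Σ (Fin (2 * d)) (λ b → (b ∈ A) × ¬ (2 ∣ toℕ b)) →
    (s : ℕ) → 2 ≤ s → s ≤ d ∸ 2 →
    (S : Subset (2 * d)) → ((x : Fin (2 * d)) → (x ∈ S ⇔ InRestrictedSumset A s x)) →
    d < ∣ S ∣
-- Matching d@(suc _) makes 2 * d a successor, so that modN agrees with _%_ and NonZero is found.
corollary1 d@(suc _) 5≤d A ∣A∣≡d (a , a∈A , 2∣a) (b , b∈A , 2∤b) s 2≤s s≤d∸2 S S-spec =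
  decidable-stable (d <? ∣ S ∣) λ d≮∣S∣ →
    2∤b (Rigidity.same-parity sums∈S (enumerate ∣A∣≡d (s≤s z≤n)) d≮∣S∣ 2≤s s≤d∸2 5≤d refl a∈A b∈A 2∣a)
  where
  sums∈S : ∀ B → B ⊆ A → ∣ B ∣ ≡ s → subsetSum B mod (2 * d) ∈ S
  sums∈S B B⊆A ∣B∣≡s = Equivalence.from (S-spec _) (B , B⊆A , ∣B∣≡s , sym (toℕ-mod (subsetSum B)))
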